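{- Let \[ \mathcal{T}_{2,n}=\{(a_1:\cdots:a_n): 0\le a_i\le 2(n-i+1)-1,\ i=1,\dots,n\}=[0,2n-1]\times[0,2n-3]\times\cdots\times[0,3]\times[0,1]. \] The map $I:B_n\to\mathcal{T}_{2,n}$ sending each $w\in B_n$ to its inversion table $I(w)=(inv_1(w):\cdots:inv_n(w))$ is a bijection.
   Context: For integers $m\le n$, $[m,n]=\{m,m+1,\dots,n\}$. Let $e_1,\dots,e_n$ be the standard basis of $\mathbb{R}^n$. The hyperoctahedral group $B_n$ is the group of signed permutations: linear maps $w$ of $\mathbb{R}^n$ with $w(e_k)=(-1)^{r_k}e_{\beta(k)}$ for some $\beta\in S_n$ and $r_k\in\{0,1\}$. The positive roots are $\Psi^+=\{e_l:1\le l\le n\}\cup\{e_j-e_i,\ e_j+e_i: 1\le i<j\le n\}$ and $\Psi^-=-\Psi^+$. For $i=1,\dots,n$ put $\Psi_i=\{e_{n+1-i}\}\cup\{e_{n+1-i}-e_j,\ e_{n+1-i}+e_j: 1\le j<n+1-i\}$ and $inv_i(w)=|w(\Psi_i)\cap\Psi^-|$. -}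

module Defs where

open import Data.Nat using (ℕ; _<_; _*_; _∸_)
open import Data.Integer as ℤ using (ℤ; +_; -_)
open import Data.Bool using (Bool; true; false; if_then_else_)
open import Data.Fin as Fin using (Fin; toℕ; opposite)
open import Data.Fin.Permutation using (Permutation′; _⟨$⟩ʳ_; _⟨$⟩ˡ_)
open import Data.Vec as Vec using (Vec; tabulate; lookup; zipWith)
open import Data.Vec.Properties using (≡-dec)
open import Data.List as List using (List; []; _∷_; _++_; concatMap; allFin; filter; length)
import Data.List.Membership.DecPropositional as DecMem
open import Data.Product using (_×_; Σ; _,_)
open import Relation.Nullary.Decidable using (does; ⌊_⌋)
open import Data.Nat using (_<?_)
open import Relation.Binary.PropositionalEquality using (_≡_)

-- Vectors of ℝ^n with integer coordinates (all roots have integer coordinates);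
-- coordinates are indexed 0-based by Fin n: e k corresponds to e_{k+1}.
Vect : ℕ → Set
Vect n = Vec ℤ n

e : ∀ {n} → Fin n → Vect n
e l = tabulate (λ k → if does (l Fin.≟ k) then + 1 else + 0)

_⊕_ _⊖_ : ∀ {n} → Vect n → Vect n → Vect n
u ⊕ v = zipWith ℤ._+_ u v
u ⊖ v = zipWith ℤ._-_ u v

neg : ∀ {n} → Vect n → Vect n
neg = Vec.map -_

-- Signed permutation: w(e_k) = (-1)^{r_k} e_{β(k)}
record SignedPerm (n : ℕ) : Set where
  field
    β : Permutation′ n
    r : Fin n → Bool
open SignedPerm public

sgn : Bool → ℤ → ℤ
sgn false x = x
sgn true x = - x

act : ∀ {n} → SignedPerm n → Vect n → Vect n
act w v = tabulate (λ j → let k = β w ⟨$⟩ˡ j in sgn (r w k) (lookup v k))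

_≈B_ : ∀ {n} → SignedPerm n → SignedPerm n → Set
w ≈B w' = (∀ k → β w ⟨$⟩ʳ k ≡ β w' ⟨$⟩ʳ k) × (∀ k → r w k ≡ r w' k)

Ψ⁺ : ∀ n → List (Vect n)
Ψ⁺ n = List.map e (allFin n)
  ++ concatMap (λ j → concatMap (λ i → (e j ⊖ e i) ∷ (e j ⊕ e i) ∷ [])
                                 (filter (λ i → toℕ i <? toℕ j) (allFin n)))
               (allFin n)

Ψ⁻ : ∀ n → List (Vect n)
Ψ⁻ n = List.map neg (Ψ⁺ n)

-- Ψ_i for i ∈ [1,n], with i = toℕ i₀ + 1 for i₀ : Fin n;
-- the index n+1-i is then (0-based) opposite i₀ = n-1-i₀.
Ψ : ∀ {n} → Fin n → List (Vect n)
Ψ {n} i₀ = e m ∷ concatMap (λ j → (e m ⊖ e j) ∷ (e m ⊕ e j) ∷ [])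
                            (filter (λ j → toℕ j <? toℕ m) (allFin n))
  where m = opposite i₀

inv : ∀ {n} → SignedPerm n → Fin n → ℕ
inv {n} w i₀ = length (filter (λ v → v ∈? Ψ⁻ n) (List.map (act w) (Ψ i₀)))
  where open DecMem {A = Vect n} (≡-dec ℤ._≟_) using (_∈?_)

I : ∀ {n} → SignedPerm n → Vec ℕ n
I w = tabulate (inv w)

-- T_{2,n}: 0 ≤ a_i ≤ 2(n-i+1)-1, i.e. a_i < 2(n-i+1); with i = toℕ i₀ + 1 this is a_i < 2 (n - toℕ i₀)
InT : ∀ n → Vec ℕ n → Set
InT n a = ∀ (i₀ : Fin n) → lookup a i₀ < 2 * (n ∸ toℕ i₀)

module Submission where

-- Write w = (β, r) and let m be the 0-based position for which Ψ_i consists of e_m and the e_m ± e_j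
-- with j < m; put σ = r m and let c be the number of j < m with β j < β m. The image w(e_m) = ±e_{β m}
-- is negative iff σ = true. For j < m the images of e_m ± e_j are the two vectors ±e_{β m} ± e_{β j} whose
-- e_{β m}-coefficient is that of w(e_m), and such a vector is a negative root iff its coefficient at the larger
-- index is negative. So both images are negative or both positive (according to σ) when β j < β m, and
-- exactly one is negative otherwise: inv_i(w) is m − c if σ = false and m + 1 + c if σ = true.
-- As c ranges over [0, m] the two cases fill [0, 2m + 1] without overlap, and the c's form the Lehmer
-- code of β, a bijection from permutations onto ∏ [0, m]; removing or inserting the value of β at the
-- last position reduces its injectivity and surjectivity to n − 1.

open import Defs
open import Data.Nat as ℕ using (ℕ; zero; suc; _+_; _*_; _∸_; _≤_; _<_; _<ᵇ_; z≤n; s≤s)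
import Data.Nat.Properties as ℕP
import Data.Nat.ListAction as ℕL
import Data.Nat.ListAction.Properties as ℕLP
open import Data.Integer as ℤ using (ℤ; -_; 0ℤ; 1ℤ; -1ℤ)
import Data.Integer.Properties as ℤP
open import Data.Bool using (Bool; true; false; if_then_else_; _∧_; not; T)
open import Data.Empty using (⊥-elim)
open import Data.Product using (_×_; Σ; ∃; _,_; proj₁; proj₂)
open import Data.Sum using (_⊎_; inj₁; inj₂)
open import Data.Fin as Fin using (Fin; toℕ; opposite; fromℕ; fromℕ<; inject₁; punchIn)
import Data.Fin.Properties as FinP
open import Data.Fin.Permutation as Perm using (Permutation; Permutation′; _⟨$⟩ʳ_; _⟨$⟩ˡ_; remove; insert)
open import Data.Vec using (Vec; tabulate; lookup; _∷_; [])
import Data.Vec.Properties as VecP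
open import Data.Vec.Functional using (init; last)
open import Data.List as List using (List; []; _∷_; concatMap; allFin; filter; length)
import Data.List.Properties as ListP
open import Data.List.Relation.Unary.Any using (here; there)
open import Data.List.Membership.Propositional using (_∈_; find; lose)
open import Data.List.Membership.Propositional.Properties
import Data.List.Membership.DecPropositional as DecMembership
open import Function using (_∘_; id)
open import Relation.Unary using (Pred; Decidable)
open import Relation.Binary.Definitions using (tri<; tri≈; tri>)
open import Relation.Nullary using (Dec; yes; no; does; ¬_)
open import Relation.Nullary.Decidable using (dec-true; dec-false)
open import Relation.Binary.PropositionalEquality
open import Algebra.Properties.CommutativeMonoid.Sum ℕP.+-0-commutativeMonoid
  using (sum; sum-cong-≗; sum-replicate-zero; sum-init-last; sum-permute; ∑-distrib-+)

private
  variable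
    n : ℕ

indicator : Bool → ℕ
indicator b = if b then 1 else 0

count : (Fin n → Bool) → ℕ
count p = sum (indicator ∘ p)

count-<ᵇ : ∀ k → k ≤ n → count (λ (j : Fin n) → toℕ j <ᵇ k) ≡ k
count-<ᵇ {zero}  zero    z≤n       = refl
count-<ᵇ {suc n} zero    _         = sum-replicate-zero n
count-<ᵇ {suc n} (suc k) (s≤s k≤n) = cong suc (count-<ᵇ k k≤n)

count-permute : (π : Permutation′ n) (p : Fin n → Bool) → count (p ∘ (π ⟨$⟩ʳ_)) ≡ count p
count-permute π p = sym (sum-permute (indicator ∘ p) π)

module _ {A : Set} {p} {P : Pred A p} (P? : Decidable P) where

  length-filter-as-sum : ∀ xs → length (filter P? xs) ≡ ℕL.sum (List.map (indicator ∘ does ∘ P?) xs)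
  length-filter-as-sum []       = refl
  length-filter-as-sum (x ∷ xs) with does (P? x)
  ... | true  = cong suc (length-filter-as-sum xs)
  ... | false = length-filter-as-sum xs

  sum-map-filter : (f : A → ℕ) → ∀ xs →
                   ℕL.sum (List.map f (filter P? xs)) ≡ ℕL.sum (List.map (λ x → if does (P? x) then f x else 0) xs)
  sum-map-filter f []       = refl
  sum-map-filter f (x ∷ xs) with does (P? x)
  ... | true  = cong (f x +_) (sum-map-filter f xs)
  ... | false = sum-map-filter f xs

sum-map-concatMap : ∀ {A B : Set} (f : B → ℕ) (g : A → List B) xs →
                    ℕL.sum (List.map f (concatMap g xs)) ≡ ℕL.sum (List.map (ℕL.sum ∘ List.map f ∘ g) xs)
sum-map-concatMap f g []       = refl
sum-map-concatMap f g (x ∷ xs) = begin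
  ℕL.sum (List.map f (g x List.++ concatMap g xs))                   ≡⟨ cong ℕL.sum (ListP.map-++ f (g x) _) ⟩
  ℕL.sum (List.map f (g x) List.++ List.map f (concatMap g xs))      ≡⟨ ℕLP.sum-++ (List.map f (g x)) _ ⟩
  ℕL.sum (List.map f (g x)) + ℕL.sum (List.map f (concatMap g xs))   ≡⟨ cong (_ +_) (sum-map-concatMap f g xs) ⟩
  ℕL.sum (List.map (ℕL.sum ∘ List.map f ∘ g) (x ∷ xs))               ∎
  where open ≡-Reasoning

sum-map-tabulate : ∀ {A : Set} (f : A → ℕ) (g : Fin n → A) → ℕL.sum (List.map f (List.tabulate g)) ≡ sum (f ∘ g)
sum-map-tabulate {zero}  f g = refl
sum-map-tabulate {suc n} f g = cong (f (g Fin.zero) +_) (sum-map-tabulate f (g ∘ Fin.suc))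

-- `does (toℕ i ℕ.<? toℕ j)`, the test filtering the roots in `Ψ⁺` and `Ψ`, reduces to `i <ᶠ j`.
infix 4 _<ᶠ_
_<ᶠ_ : Fin n → Fin n → Bool
i <ᶠ j = toℕ i <ᵇ toℕ j

<ᶠ⇒< : ∀ (i j : Fin n) → (i <ᶠ j) ≡ true → i Fin.< j
<ᶠ⇒< i j i<ᶠj = ℕP.<ᵇ⇒< (toℕ i) (toℕ j) (subst T (sym i<ᶠj) _)

≮ᶠ⇒≮ : ∀ (i j : Fin n) → (i <ᶠ j) ≡ false → ¬ i Fin.< j
≮ᶠ⇒≮ i j i≮ᶠj i<j = subst T i≮ᶠj (ℕP.<⇒<ᵇ i<j)

<ᵇ-irrefl : ∀ m → (m <ᵇ m) ≡ false
<ᵇ-irrefl zero    = refl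
<ᵇ-irrefl (suc m) = <ᵇ-irrefl m

inject₁<ᶠfromℕ : (j : Fin n) → (inject₁ j <ᶠ fromℕ n) ≡ true
inject₁<ᶠfromℕ Fin.zero    = refl
inject₁<ᶠfromℕ (Fin.suc j) = inject₁<ᶠfromℕ j

fromℕ≮ᶠinject₁ : (j : Fin n) → (fromℕ n <ᶠ inject₁ j) ≡ false
fromℕ≮ᶠinject₁ Fin.zero    = refl
fromℕ≮ᶠinject₁ (Fin.suc j) = fromℕ≮ᶠinject₁ j

punchIn-preserves-<ᶠ : (v : Fin (suc n)) (x y : Fin n) → (punchIn v x <ᶠ punchIn v y) ≡ (x <ᶠ y)
punchIn-preserves-<ᶠ Fin.zero    x           y           = refl
punchIn-preserves-<ᶠ (Fin.suc v) Fin.zero    Fin.zero    = refl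
punchIn-preserves-<ᶠ (Fin.suc v) Fin.zero    (Fin.suc y) = refl
punchIn-preserves-<ᶠ (Fin.suc v) (Fin.suc x) Fin.zero    = refl
punchIn-preserves-<ᶠ (Fin.suc v) (Fin.suc x) (Fin.suc y) = punchIn-preserves-<ᶠ v x y

punchIn-fromℕ : (j : Fin n) → punchIn (fromℕ n) j ≡ inject₁ j
punchIn-fromℕ Fin.zero    = refl
punchIn-fromℕ (Fin.suc j) = cong Fin.suc (punchIn-fromℕ j)

inject₁-preserves-<ᶠ : (i j : Fin n) → (inject₁ i <ᶠ inject₁ j) ≡ (i <ᶠ j)
inject₁-preserves-<ᶠ {n} i j =
  trans (cong₂ _<ᶠ_ (sym (punchIn-fromℕ i)) (sym (punchIn-fromℕ j))) (punchIn-preserves-<ᶠ (fromℕ n) i j)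

fromℕ-or-inject₁ : (k : Fin (suc n)) → k ≡ fromℕ n ⊎ ∃ λ j → k ≡ inject₁ j
fromℕ-or-inject₁ {zero}  Fin.zero    = inj₁ refl
fromℕ-or-inject₁ {suc n} Fin.zero    = inj₂ (Fin.zero , refl)
fromℕ-or-inject₁ {suc n} (Fin.suc k) with fromℕ-or-inject₁ k
... | inj₁ k≡n       = inj₁ (cong Fin.suc k≡n)
... | inj₂ (j , k≡j) = inj₂ (Fin.suc j , cong Fin.suc k≡j)

snoc : ∀ {A : Set} → (Fin n → A) → A → Fin (suc n) → A
snoc {zero}  f a _           = a
snoc {suc n} f a Fin.zero    = f Fin.zero
snoc {suc n} f a (Fin.suc k) = snoc (f ∘ Fin.suc) a k

last-snoc : ∀ {A : Set} (f : Fin n → A) a → last (snoc f a) ≡ a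
last-snoc {zero}  f a = refl
last-snoc {suc n} f a = last-snoc (f ∘ Fin.suc) a

init-snoc : ∀ {A : Set} (f : Fin n → A) a → init (snoc f a) ≗ f
init-snoc {suc n} f a Fin.zero    = refl
init-snoc {suc n} f a (Fin.suc j) = init-snoc (f ∘ Fin.suc) a j

-- Lehmer codes

permute-injective : (π : Permutation′ n) {i j : Fin n} → π ⟨$⟩ʳ i ≡ π ⟨$⟩ʳ j → i ≡ j
permute-injective π eq = trans (sym (Perm.inverseˡ π)) (trans (cong (π ⟨$⟩ˡ_) eq) (Perm.inverseˡ π))

insert-at : ∀ {m} (i : Fin (suc m)) (j : Fin (suc n)) (π : Permutation m n) → insert i j π ⟨$⟩ʳ i ≡ j
insert-at i j π with i Fin.≟ i
... | yes _   = refl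
... | no  i≢i = ⊥-elim (i≢i refl)

removeLast : Permutation′ (suc n) → Permutation′ n
removeLast {n} = remove (fromℕ n)

permute-inject₁ : (π : Permutation′ (suc n)) (j : Fin n) →
                  π ⟨$⟩ʳ inject₁ j ≡ punchIn (π ⟨$⟩ʳ fromℕ n) (removeLast π ⟨$⟩ʳ j)
permute-inject₁ {n} π j = trans (cong (π ⟨$⟩ʳ_) (sym (punchIn-fromℕ j))) (Perm.punchIn-permute π (fromℕ n) j)

smallerBefore : Permutation′ n → Fin n → ℕ
smallerBefore π m = count (λ j → (j <ᶠ m) ∧ (π ⟨$⟩ʳ j <ᶠ π ⟨$⟩ʳ m))

smallerBefore-fromℕ : (π : Permutation′ (suc n)) → smallerBefore π (fromℕ n) ≡ toℕ (π ⟨$⟩ʳ fromℕ n)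
smallerBefore-fromℕ {n} π = begin
  smallerBefore π (fromℕ n)  ≡⟨ sum-init-last f ⟩
  sum (init f) + last f      ≡⟨ cong₂ _+_ (sum-cong-≗ init-agrees) last-agrees ⟩
  sum (init g) + last g      ≡⟨ sum-init-last g ⟨
  count (smaller ∘ (π ⟨$⟩ʳ_)) ≡⟨ count-permute π smaller ⟩
  count smaller              ≡⟨ count-<ᵇ (toℕ v) (FinP.toℕ≤n v) ⟩
  toℕ v                      ∎
  where
  open ≡-Reasoning
  v = π ⟨$⟩ʳ fromℕ n
  smaller : Fin (suc n) → Bool
  smaller = _<ᶠ v
  f g : Fin (suc n) → ℕ
  f j = indicator ((j <ᶠ fromℕ n) ∧ smaller (π ⟨$⟩ʳ j))
  g j = indicator (smaller (π ⟨$⟩ʳ j))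
  init-agrees : ∀ j → init f j ≡ init g j
  init-agrees j rewrite inject₁<ᶠfromℕ j = refl
  last-agrees : last f ≡ last g
  last-agrees rewrite <ᵇ-irrefl (toℕ (fromℕ n)) | <ᵇ-irrefl (toℕ v) = refl

smallerBefore-inject₁ : (π : Permutation′ (suc n)) (m : Fin n) →
                        smallerBefore π (inject₁ m) ≡ smallerBefore (removeLast π) m
smallerBefore-inject₁ {n} π m = begin
  smallerBefore π (inject₁ m)         ≡⟨ sum-init-last f ⟩
  sum (init f) + last f               ≡⟨ cong₂ _+_ (sum-cong-≗ init-agrees) last-vanishes ⟩
  smallerBefore (removeLast π) m + 0  ≡⟨ ℕP.+-identityʳ _ ⟩
  smallerBefore (removeLast π) m      ∎
  where
  open ≡-Reasoning
  f : Fin (suc n) → ℕ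
  f j = indicator ((j <ᶠ inject₁ m) ∧ (π ⟨$⟩ʳ j <ᶠ π ⟨$⟩ʳ inject₁ m))
  init-agrees : ∀ j → init f j ≡ indicator ((j <ᶠ m) ∧ (removeLast π ⟨$⟩ʳ j <ᶠ removeLast π ⟨$⟩ʳ m))
  init-agrees j = cong₂ (λ a b → indicator (a ∧ b)) (inject₁-preserves-<ᶠ j m)
    (trans (cong₂ _<ᶠ_ (permute-inject₁ π j) (permute-inject₁ π m)) (punchIn-preserves-<ᶠ (π ⟨$⟩ʳ fromℕ n) _ _))
  last-vanishes : last f ≡ 0
  last-vanishes rewrite fromℕ≮ᶠinject₁ m = refl

entry : Bool → ℕ → ℕ → ℕ
entry true  c m = suc (m + c)
entry false c m = m ∸ c

2*suc : ∀ m → 2 * suc m ≡ suc m + suc m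
2*suc m = cong (suc m ℕ.+_) (ℕP.+-identityʳ (suc m))

entry-< : ∀ σ {c m} → c ≤ m → entry σ c m < 2 * suc m
entry-< true  {c} {m} c≤m = begin-strict
  suc (m + c)    <⟨ s≤s (ℕP.+-monoʳ-< m (s≤s c≤m)) ⟩
  suc m + suc m  ≡⟨ 2*suc m ⟨
  2 * suc m      ∎
  where open ℕP.≤-Reasoning
entry-< false {c} {m} _ = s≤s (ℕP.≤-trans (ℕP.m∸n≤m m c) (ℕP.m≤m+n m _))

entry-injective : ∀ {σ σ′ c c′ m} → c ≤ m → c′ ≤ m → entry σ c m ≡ entry σ′ c′ m → σ ≡ σ′ × c ≡ c′
entry-injective {true}  {true}  {c} {c′} {m} _   _    eq = refl , ℕP.+-cancelˡ-≡ m c c′ (ℕP.suc-injective eq)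
entry-injective {false} {false} {c} {c′} {m} c≤m c′≤m eq = refl , (begin
  c             ≡⟨ ℕP.m∸[m∸n]≡n c≤m ⟨
  m ∸ (m ∸ c)   ≡⟨ cong (m ∸_) eq ⟩
  m ∸ (m ∸ c′)  ≡⟨ ℕP.m∸[m∸n]≡n c′≤m ⟩
  c′            ∎)
  where open ≡-Reasoning
entry-injective {true}  {false} {c} {c′} {m} _ _ eq =
  ⊥-elim (ℕP.<-irrefl (sym eq) (s≤s (ℕP.≤-trans (ℕP.m∸n≤m m c′) (ℕP.m≤m+n m c))))
entry-injective {false} {true}  {c} {c′} {m} _ _ eq =
  ⊥-elim (ℕP.<-irrefl eq (s≤s (ℕP.≤-trans (ℕP.m∸n≤m m c) (ℕP.m≤m+n m c′))))

entry-surjective : ∀ m x → x < 2 * suc m → Σ Bool λ σ → Σ ℕ λ c → c ≤ m × entry σ c m ≡ x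
entry-surjective m x x<2[1+m] with x ℕ.≤? m
... | yes x≤m = false , m ∸ x , ℕP.m∸n≤m m x , ℕP.m∸[m∸n]≡n x≤m
... | no  x≰m = true , x ∸ suc m , ℕ.s≤s⁻¹ (ℕP.m<n+o⇒m∸n<o x (suc m) (subst (x <_) (2*suc m) x<2[1+m]))
                     , ℕP.m+[n∸m]≡n (ℕP.≰⇒> x≰m)

entry-sum : ∀ σ (L X : Fin n → Bool) →
            indicator σ + sum (λ j → if L j then (if X j then indicator σ + indicator σ else 1) else 0)
            ≡ entry σ (count (λ j → L j ∧ X j)) (count L)
entry-sum true  L X = cong suc (trans (sum-cong-≗ split) (∑-distrib-+ (indicator ∘ L) (λ j → indicator (L j ∧ X j))))
  where
  split : ∀ j → (if L j then (if X j then 2 else 1) else 0) ≡ indicator (L j) + indicator (L j ∧ X j)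
  split j with L j | X j
  ... | true  | true  = refl
  ... | true  | false = refl
  ... | false | _     = refl
entry-sum false L X = begin
  sum y                          ≡⟨ ℕP.m+n∸n≡m (sum y) (count L∧X) ⟨
  sum y + count L∧X ∸ count L∧X  ≡⟨ cong (_∸ count L∧X) (∑-distrib-+ y (indicator ∘ L∧X)) ⟨
  sum (λ j → y j + indicator (L∧X j)) ∸ count L∧X ≡⟨ cong (_∸ count L∧X) (sum-cong-≗ complement) ⟩
  count L ∸ count L∧X            ∎
  where
  open ≡-Reasoning
  L∧X : Fin _ → Bool
  L∧X j = L j ∧ X j
  y : Fin _ → ℕ
  y j = if L j then (if X j then 0 else 1) else 0
  complement : ∀ j → y j + indicator (L∧X j) ≡ indicator (L j)
  complement j with L j | X j
  ... | true  | true  = refl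
  ... | true  | false = refl
  ... | false | _     = refl

invCount : Permutation′ n → (Fin n → Bool) → Fin n → ℕ
invCount π s m = entry (s m) (smallerBefore π m) (toℕ m)

table : Permutation′ n → (Fin n → Bool) → Vec ℕ n
table π s = tabulate (invCount π s ∘ opposite)

table-∷ : (π : Permutation′ (suc n)) (s : Fin (suc n) → Bool) →
          table π s ≡ entry (last s) (toℕ (π ⟨$⟩ʳ fromℕ n)) n ∷ table (removeLast π) (init s)
table-∷ {n} π s = cong₂ _∷_
  (cong₂ (entry (last s)) (smallerBefore-fromℕ π) (FinP.toℕ-fromℕ n))
  (VecP.tabulate-cong λ i → cong₂ (entry (s (inject₁ (opposite i))))
    (smallerBefore-inject₁ π (opposite i)) (FinP.toℕ-inject₁ (opposite i)))

table-cong : ∀ {π π′ : Permutation′ n} {s s′ : Fin n → Bool} → π Perm.≈ π′ → s ≗ s′ → table π s ≡ table π′ s′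
table-cong π≈π′ s≗s′ = VecP.tabulate-cong λ i →
  cong₂ (λ σ c → entry σ c (toℕ (opposite i))) (s≗s′ (opposite i)) (sum-cong-≗ λ j →
    cong₂ (λ a b → indicator ((j <ᶠ opposite i) ∧ (a <ᶠ b))) (π≈π′ j) (π≈π′ (opposite i)))

InT-∷ : ∀ {x} {xs : Vec ℕ n} → x < 2 * suc n → InT n xs → InT (suc n) (x ∷ xs)
InT-∷ x< xs∈T Fin.zero    = x<
InT-∷ x< xs∈T (Fin.suc i) = xs∈T i

table-bounded : (π : Permutation′ n) (s : Fin n → Bool) → InT n (table π s)
table-bounded {zero}  π s ()
table-bounded {suc n} π s = subst (InT (suc n)) (sym (table-∷ π s))
  (InT-∷ (entry-< (last s) (FinP.toℕ≤pred[n] (π ⟨$⟩ʳ fromℕ n))) (table-bounded (removeLast π) (init s)))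

table-injective : (π π′ : Permutation′ n) (s s′ : Fin n → Bool) → table π s ≡ table π′ s′ → π Perm.≈ π′ × s ≗ s′
table-injective {zero}  π π′ s s′ _  = (λ ()) , (λ ())
table-injective {suc n} π π′ s s′ eq = π≈π′ , s≗s′
  where
  last-eq : last s ≡ last s′ × toℕ (π ⟨$⟩ʳ fromℕ n) ≡ toℕ (π′ ⟨$⟩ʳ fromℕ n)
  last-eq = entry-injective (FinP.toℕ≤pred[n] (π ⟨$⟩ʳ fromℕ n)) (FinP.toℕ≤pred[n] (π′ ⟨$⟩ʳ fromℕ n))
    (VecP.∷-injectiveˡ (trans (sym (table-∷ π s)) (trans eq (table-∷ π′ s′))))
  init-eq : removeLast π Perm.≈ removeLast π′ × init s ≗ init s′
  init-eq = table-injective (removeLast π) (removeLast π′) (init s) (init s′)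
    (VecP.∷-injectiveʳ (trans (sym (table-∷ π s)) (trans eq (table-∷ π′ s′))))
  π≈π′ : π Perm.≈ π′
  π≈π′ k with fromℕ-or-inject₁ k
  ... | inj₁ refl       = FinP.toℕ-injective (proj₂ last-eq)
  ... | inj₂ (j , refl) = begin
    π ⟨$⟩ʳ inject₁ j                                  ≡⟨ permute-inject₁ π j ⟩
    punchIn (π ⟨$⟩ʳ fromℕ n) (removeLast π ⟨$⟩ʳ j)    ≡⟨ cong₂ punchIn (FinP.toℕ-injective (proj₂ last-eq))
                                                                       (proj₁ init-eq j) ⟩
    punchIn (π′ ⟨$⟩ʳ fromℕ n) (removeLast π′ ⟨$⟩ʳ j)  ≡⟨ permute-inject₁ π′ j ⟨
    π′ ⟨$⟩ʳ inject₁ j                                 ∎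
    where open ≡-Reasoning
  s≗s′ : s ≗ s′
  s≗s′ k with fromℕ-or-inject₁ k
  ... | inj₁ refl       = proj₁ last-eq
  ... | inj₂ (j , refl) = proj₂ init-eq j

table-surjective : (a : Vec ℕ n) → InT n a → Σ (Permutation′ n) λ π → Σ (Fin n → Bool) λ s → table π s ≡ a
table-surjective {zero}  []       _    = Perm.id , (λ ()) , refl
table-surjective {suc n} (x ∷ xs) x∷xs∈T
  with entry-surjective n x (x∷xs∈T Fin.zero) | table-surjective xs (x∷xs∈T ∘ Fin.suc)
... | σ , c , c≤n , entry≡x | π′ , s′ , table≡xs = π , s , trans (table-∷ π s) (cong₂ _∷_ head≡x tail≡xs)
  where
  v : Fin (suc n)
  v = fromℕ< (s≤s c≤n)
  π : Permutation′ (suc n)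
  π = insert (fromℕ n) v π′
  s : Fin (suc n) → Bool
  s = snoc s′ σ
  head≡x : entry (last s) (toℕ (π ⟨$⟩ʳ fromℕ n)) n ≡ x
  head≡x rewrite last-snoc s′ σ | insert-at (fromℕ n) v π′ | FinP.toℕ-fromℕ< (s≤s c≤n) = entry≡x
  tail≡xs : table (removeLast π) (init s) ≡ xs
  tail≡xs = trans (table-cong {π = removeLast π} {π′} {init s} {s′} (Perm.remove-insert (fromℕ n) v π′) (init-snoc s′ σ))
                  table≡xs

-- Roots

neg-involutive : (u : Vect n) → neg (neg u) ≡ u
neg-involutive []      = refl
neg-involutive (x ∷ u) = cong₂ _∷_ (ℤP.neg-involutive x) (neg-involutive u)

neg-distrib-⊕ : (u v : Vect n) → neg (u ⊕ v) ≡ neg u ⊕ neg v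
neg-distrib-⊕ []      []      = refl
neg-distrib-⊕ (x ∷ u) (y ∷ v) = cong₂ _∷_ (ℤP.neg-distrib-+ x y) (neg-distrib-⊕ u v)

⊖-as-⊕ : (u v : Vect n) → u ⊖ v ≡ u ⊕ neg v
⊖-as-⊕ []      []      = refl
⊖-as-⊕ (x ∷ u) (y ∷ v) = cong (_ ∷_) (⊖-as-⊕ u v)

⊕-comm : (u v : Vect n) → u ⊕ v ≡ v ⊕ u
⊕-comm = VecP.zipWith-comm ℤP.+-comm

lookup-⊕ : (u v : Vect n) (k : Fin n) → lookup (u ⊕ v) k ≡ lookup u k ℤ.+ lookup v k
lookup-⊕ u v k = VecP.lookup-zipWith ℤ._+_ k u v

lookup-ext : {u v : Vect n} → (∀ k → lookup u k ≡ lookup v k) → u ≡ v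
lookup-ext {u = u} {v} u≗v =
  trans (sym (VecP.tabulate∘lookup u)) (trans (VecP.tabulate-cong u≗v) (VecP.tabulate∘lookup v))

sgn-0 : ∀ σ → sgn σ 0ℤ ≡ 0ℤ
sgn-0 false = refl
sgn-0 true  = refl

sgn-distrib-+ : ∀ σ x y → sgn σ (x ℤ.+ y) ≡ sgn σ x ℤ.+ sgn σ y
sgn-distrib-+ false x y = refl
sgn-distrib-+ true  x y = ℤP.neg-distrib-+ x y

sgn-neg : ∀ σ x → sgn σ (- x) ≡ - sgn σ x
sgn-neg false x = refl
sgn-neg true  x = refl

±e : Bool → Fin n → Vect n
±e false a = e a
±e true  a = neg (e a)

neg-±e : ∀ σ (a : Fin n) → neg (±e σ a) ≡ ±e (not σ) a
neg-±e false a = refl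
neg-±e true  a = neg-involutive (e a)

lookup-±e : ∀ σ (a k : Fin n) → lookup (±e σ a) k ≡ sgn σ (if does (a Fin.≟ k) then 1ℤ else 0ℤ)
lookup-±e false a k = VecP.lookup∘tabulate _ k
lookup-±e true  a k = trans (VecP.lookup-map k -_ (e a)) (cong -_ (VecP.lookup∘tabulate _ k))

lookup-±e-self : ∀ σ (a : Fin n) → lookup (±e σ a) a ≡ sgn σ 1ℤ
lookup-±e-self σ a =
  trans (lookup-±e σ a a) (cong (λ b → sgn σ (if b then 1ℤ else 0ℤ)) (dec-true (a Fin.≟ a) refl))

lookup-±e-other : ∀ σ {a k : Fin n} → a ≢ k → lookup (±e σ a) k ≡ 0ℤ
lookup-±e-other σ {a} {k} a≢k =
  trans (lookup-±e σ a k) (trans (cong (λ b → sgn σ (if b then 1ℤ else 0ℤ)) (dec-false (a Fin.≟ k) a≢k)) (sgn-0 σ))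

LeadingCoeff : ℤ → Vect n → Set
LeadingCoeff z v = Σ (Fin _) λ t → lookup v t ≡ z × (∀ k → t Fin.< k → lookup v k ≡ 0ℤ)

leadingCoeff-unique : ∀ {x y} {v : Vect n} → x ≢ 0ℤ → y ≢ 0ℤ → LeadingCoeff x v → LeadingCoeff y v → x ≡ y
leadingCoeff-unique x≢0 y≢0 (t , vt≡x , above-t) (t′ , vt′≡y , above-t′) with FinP.<-cmp t t′
... | tri< t<t′ _ _ = ⊥-elim (y≢0 (trans (sym vt′≡y) (above-t t′ t<t′)))
... | tri≈ _ refl _ = trans (sym vt≡x) vt′≡y
... | tri> _ _ t>t′ = ⊥-elim (x≢0 (trans (sym vt≡x) (above-t′ t t>t′)))

±e-leadingCoeff : ∀ σ (a : Fin n) → LeadingCoeff (sgn σ 1ℤ) (±e σ a)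
±e-leadingCoeff σ a = a , lookup-±e-self σ a , λ k a<k → lookup-±e-other σ (FinP.<⇒≢ a<k)

±e⊕±e-leadingCoeff : ∀ σ τ {a b : Fin n} → b Fin.< a → LeadingCoeff (sgn σ 1ℤ) (±e σ a ⊕ ±e τ b)
±e⊕±e-leadingCoeff σ τ {a} {b} b<a = a , top , above
  where
  top : lookup (±e σ a ⊕ ±e τ b) a ≡ sgn σ 1ℤ
  top = trans (lookup-⊕ (±e σ a) (±e τ b) a)
    (trans (cong₂ ℤ._+_ (lookup-±e-self σ a) (lookup-±e-other τ (FinP.<⇒≢ b<a))) (ℤP.+-identityʳ _))
  above : ∀ k → a Fin.< k → lookup (±e σ a ⊕ ±e τ b) k ≡ 0ℤ
  above k a<k = trans (lookup-⊕ (±e σ a) (±e τ b) k)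
    (cong₂ ℤ._+_ (lookup-±e-other σ (FinP.<⇒≢ a<k)) (lookup-±e-other τ (FinP.<⇒≢ (ℕP.<-trans b<a a<k))))

Ψ⁺-pair : Bool → Fin n → Fin n → Vect n
Ψ⁺-pair false a b = e a ⊖ e b
Ψ⁺-pair true  a b = e a ⊕ e b

neg-Ψ⁺-pair : ∀ τ (a b : Fin n) → neg (Ψ⁺-pair τ a b) ≡ ±e true a ⊕ ±e τ b
neg-Ψ⁺-pair true  a b = neg-distrib-⊕ (e a) (e b)
neg-Ψ⁺-pair false a b = begin
  neg (e a ⊖ e b)              ≡⟨ cong neg (⊖-as-⊕ (e a) (e b)) ⟩
  neg (e a ⊕ neg (e b))        ≡⟨ neg-distrib-⊕ (e a) (neg (e b)) ⟩
  neg (e a) ⊕ neg (neg (e b))  ≡⟨ cong (neg (e a) ⊕_) (neg-involutive (e b)) ⟩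
  neg (e a) ⊕ e b              ∎
  where open ≡-Reasoning

below : Fin n → List (Fin n)
below a = filter (λ i → toℕ i ℕ.<? toℕ a) (allFin _)

pairs : Fin n → List (Vect n)
pairs a = concatMap (λ b → (e a ⊖ e b) ∷ (e a ⊕ e b) ∷ []) (below a)

∈-below⁻ : ∀ {a b : Fin n} → b ∈ below a → b Fin.< a
∈-below⁻ {a = a} b∈ = proj₂ (∈-filter⁻ (λ i → toℕ i ℕ.<? toℕ a) {xs = allFin _} b∈)

∈-below⁺ : ∀ {a b : Fin n} → b Fin.< a → b ∈ below a
∈-below⁺ {a = a} {b} b<a = ∈-filter⁺ (λ i → toℕ i ℕ.<? toℕ a) (∈-allFin b) b<a

Ψ⁺-pair∈pairs : ∀ τ {a b : Fin n} → b Fin.< a → Ψ⁺-pair τ a b ∈ pairs a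
Ψ⁺-pair∈pairs τ {a} {b} b<a = ∈-concatMap⁺ _ (lose (∈-below⁺ b<a) (pair∈ τ))
  where
  pair∈ : ∀ τ → Ψ⁺-pair τ a b ∈ (e a ⊖ e b) ∷ (e a ⊕ e b) ∷ []
  pair∈ false = here refl
  pair∈ true  = there (here refl)

∈-pairs⁻ : ∀ {a : Fin n} {u} → u ∈ pairs a → Σ Bool λ τ → Σ (Fin n) λ b → b Fin.< a × u ≡ Ψ⁺-pair τ a b
∈-pairs⁻ {a = a} u∈ with find (∈-concatMap⁻ _ {xs = below a} u∈)
... | b , b∈ , here refl         = false , b , ∈-below⁻ b∈ , refl
... | b , b∈ , there (here refl) = true , b , ∈-below⁻ b∈ , refl

-e∈Ψ⁻ : (a : Fin n) → ±e true a ∈ Ψ⁻ n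
-e∈Ψ⁻ a = ∈-map⁺ neg (∈-++⁺ˡ (∈-map⁺ e (∈-allFin a)))

-e±e∈Ψ⁻ : ∀ τ {a b : Fin n} → b Fin.< a → ±e true a ⊕ ±e τ b ∈ Ψ⁻ n
-e±e∈Ψ⁻ {n} τ {a} {b} b<a = subst (_∈ Ψ⁻ n) (neg-Ψ⁺-pair τ a b)
  (∈-map⁺ neg (∈-++⁺ʳ (List.map e (allFin n)) (∈-concatMap⁺ pairs (lose (∈-allFin a) (Ψ⁺-pair∈pairs τ b<a)))))

∈Ψ⁻⇒leadingCoeff : {v : Vect n} → v ∈ Ψ⁻ n → LeadingCoeff -1ℤ v
∈Ψ⁻⇒leadingCoeff {n} v∈Ψ⁻ with ∈-map⁻ neg v∈Ψ⁻
... | u , u∈Ψ⁺ , refl with ∈-++⁻ (List.map e (allFin n)) u∈Ψ⁺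
... | inj₁ u∈e with ∈-map⁻ e u∈e
...   | a , _ , refl = ±e-leadingCoeff true a
∈Ψ⁻⇒leadingCoeff {n} v∈Ψ⁻ | u , u∈Ψ⁺ , refl | inj₂ u∈pairs with find (∈-concatMap⁻ pairs {xs = allFin n} u∈pairs)
... | a , _ , u∈pairs-a with ∈-pairs⁻ u∈pairs-a
...   | τ , b , b<a , refl = subst (LeadingCoeff -1ℤ) (sym (neg-Ψ⁺-pair τ a b)) (±e⊕±e-leadingCoeff true τ b<a)

negative? : (v : Vect n) → Dec (v ∈ Ψ⁻ n)
negative? {n} v = DecMembership._∈?_ (VecP.≡-dec ℤ._≟_) v (Ψ⁻ n)

isNegative : Vect n → Bool
isNegative v = does (negative? v)

leadingCoeff-1⇒¬negative : {v : Vect n} → LeadingCoeff 1ℤ v → isNegative v ≡ false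
leadingCoeff-1⇒¬negative {v = v} lc = dec-false (negative? v)
  λ v∈Ψ⁻ → 1≢-1 (leadingCoeff-unique {v = v} (λ ()) (λ ()) lc (∈Ψ⁻⇒leadingCoeff v∈Ψ⁻))
  where
  1≢-1 : 1ℤ ≢ -1ℤ
  1≢-1 ()

isNegative-±e : ∀ σ (a : Fin n) → isNegative (±e σ a) ≡ σ
isNegative-±e true  a = dec-true (negative? _) (-e∈Ψ⁻ a)
isNegative-±e false a = leadingCoeff-1⇒¬negative (±e-leadingCoeff false a)

isNegative-±e⊕±e : ∀ σ τ {a b : Fin n} → b Fin.< a → isNegative (±e σ a ⊕ ±e τ b) ≡ σ
isNegative-±e⊕±e true  τ b<a = dec-true (negative? _) (-e±e∈Ψ⁻ τ b<a)
isNegative-±e⊕±e false τ b<a = leadingCoeff-1⇒¬negative (±e⊕±e-leadingCoeff false τ b<a)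

negatives-in-pair : ∀ σ τ {a b : Fin n} → a ≢ b →
  indicator (isNegative (±e σ a ⊕ ±e (not τ) b)) + indicator (isNegative (±e σ a ⊕ ±e τ b))
  ≡ (if b <ᶠ a then indicator σ + indicator σ else 1)
negatives-in-pair σ τ {a} {b} a≢b with b <ᶠ a in b<ᶠa
... | true  = cong₂ (λ x y → indicator x + indicator y)
                (isNegative-±e⊕±e σ (not τ) (<ᶠ⇒< b a b<ᶠa)) (isNegative-±e⊕±e σ τ (<ᶠ⇒< b a b<ᶠa))
... | false = begin
  indicator (isNegative (±e σ a ⊕ ±e (not τ) b)) + indicator (isNegative (±e σ a ⊕ ±e τ b))
    ≡⟨ cong₂ (λ x y → indicator (isNegative x) + indicator (isNegative y))
             (⊕-comm (±e σ a) _) (⊕-comm (±e σ a) _) ⟩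
  indicator (isNegative (±e (not τ) b ⊕ ±e σ a)) + indicator (isNegative (±e τ b ⊕ ±e σ a))
    ≡⟨ cong₂ (λ x y → indicator x + indicator y) (isNegative-±e⊕±e (not τ) σ a<b) (isNegative-±e⊕±e τ σ a<b) ⟩
  indicator (not τ) + indicator τ
    ≡⟨ exactly-one τ ⟩
  1 ∎
  where
  open ≡-Reasoning
  a<b : a Fin.< b
  a<b = FinP.≤∧≢⇒< (ℕP.≮⇒≥ (≮ᶠ⇒≮ b a b<ᶠa)) a≢b
  exactly-one : ∀ τ → indicator (not τ) + indicator τ ≡ 1
  exactly-one true  = refl
  exactly-one false = refl

-- Inversions of a signed permutation

module _ (w : SignedPerm n) where

  lookup-act : (v : Vect n) (k : Fin n) → lookup (act w v) k ≡ sgn (r w (β w ⟨$⟩ˡ k)) (lookup v (β w ⟨$⟩ˡ k))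
  lookup-act v = VecP.lookup∘tabulate _

  act-⊕ : (u v : Vect n) → act w (u ⊕ v) ≡ act w u ⊕ act w v
  act-⊕ u v = lookup-ext λ k → let k′ = β w ⟨$⟩ˡ k ; σ = r w k′ in begin
    lookup (act w (u ⊕ v)) k                     ≡⟨ lookup-act (u ⊕ v) k ⟩
    sgn σ (lookup (u ⊕ v) k′)                    ≡⟨ cong (sgn σ) (lookup-⊕ u v k′) ⟩
    sgn σ (lookup u k′ ℤ.+ lookup v k′)          ≡⟨ sgn-distrib-+ σ _ _ ⟩
    sgn σ (lookup u k′) ℤ.+ sgn σ (lookup v k′)  ≡⟨ cong₂ ℤ._+_ (lookup-act u k) (lookup-act v k) ⟨
    lookup (act w u) k ℤ.+ lookup (act w v) k    ≡⟨ lookup-⊕ (act w u) (act w v) k ⟨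
    lookup (act w u ⊕ act w v) k                 ∎
    where open ≡-Reasoning

  act-neg : (u : Vect n) → act w (neg u) ≡ neg (act w u)
  act-neg u = lookup-ext λ k → let k′ = β w ⟨$⟩ˡ k ; σ = r w k′ in begin
    lookup (act w (neg u)) k   ≡⟨ lookup-act (neg u) k ⟩
    sgn σ (lookup (neg u) k′)  ≡⟨ cong (sgn σ) (VecP.lookup-map k′ -_ u) ⟩
    sgn σ (- lookup u k′)      ≡⟨ sgn-neg σ _ ⟩
    - sgn σ (lookup u k′)      ≡⟨ cong -_ (lookup-act u k) ⟨
    - lookup (act w u) k       ≡⟨ VecP.lookup-map k -_ (act w u) ⟨
    lookup (neg (act w u)) k   ∎
    where open ≡-Reasoning

  act-e : (m : Fin n) → act w (e m) ≡ ±e (r w m) (β w ⟨$⟩ʳ m)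
  act-e m = lookup-ext λ k → trans (lookup-act (e m) k) (coordinate k)
    where
    coordinate : ∀ k → sgn (r w (β w ⟨$⟩ˡ k)) (lookup (e m) (β w ⟨$⟩ˡ k)) ≡ lookup (±e (r w m) (β w ⟨$⟩ʳ m)) k
    coordinate k with m Fin.≟ β w ⟨$⟩ˡ k
    ... | yes refl = begin
      sgn (r w m) (lookup (e m) m)                  ≡⟨ cong (sgn (r w m)) (lookup-±e-self false m) ⟩
      sgn (r w m) 1ℤ                                ≡⟨ lookup-±e-self (r w m) k ⟨
      lookup (±e (r w m) k) k                       ≡⟨ cong (λ x → lookup (±e (r w m) x) k) (Perm.inverseʳ (β w)) ⟨
      lookup (±e (r w m) (β w ⟨$⟩ʳ m)) k            ∎
      where open ≡-Reasoning
    ... | no m≢k′  = begin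
      sgn σ (lookup (e m) (β w ⟨$⟩ˡ k))   ≡⟨ cong (sgn σ) (lookup-±e-other false m≢k′) ⟩
      sgn σ 0ℤ                           ≡⟨ sgn-0 σ ⟩
      0ℤ                                 ≡⟨ lookup-±e-other (r w m) βm≢k ⟨
      lookup (±e (r w m) (β w ⟨$⟩ʳ m)) k  ∎
      where
      open ≡-Reasoning
      σ : Bool
      σ = r w (β w ⟨$⟩ˡ k)
      βm≢k : β w ⟨$⟩ʳ m ≢ k
      βm≢k βm≡k = m≢k′ (permute-injective (β w) (trans βm≡k (sym (Perm.inverseʳ (β w)))))

  act-e⊕e : (m j : Fin n) → act w (e m ⊕ e j) ≡ ±e (r w m) (β w ⟨$⟩ʳ m) ⊕ ±e (r w j) (β w ⟨$⟩ʳ j)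
  act-e⊕e m j = trans (act-⊕ (e m) (e j)) (cong₂ _⊕_ (act-e m) (act-e j))

  act-e⊖e : (m j : Fin n) → act w (e m ⊖ e j) ≡ ±e (r w m) (β w ⟨$⟩ʳ m) ⊕ ±e (not (r w j)) (β w ⟨$⟩ʳ j)
  act-e⊖e m j = begin
    act w (e m ⊖ e j)                                        ≡⟨ cong (act w) (⊖-as-⊕ (e m) (e j)) ⟩
    act w (e m ⊕ neg (e j))                                  ≡⟨ act-⊕ (e m) (neg (e j)) ⟩
    act w (e m) ⊕ act w (neg (e j))                          ≡⟨ cong (act w (e m) ⊕_) (act-neg (e j)) ⟩
    act w (e m) ⊕ neg (act w (e j))                          ≡⟨ cong₂ (λ u v → u ⊕ neg v) (act-e m) (act-e j) ⟩
    ±e (r w m) (β w ⟨$⟩ʳ m) ⊕ neg (±e (r w j) (β w ⟨$⟩ʳ j))  ≡⟨ cong (_ ⊕_) (neg-±e (r w j) _) ⟩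
    ±e (r w m) (β w ⟨$⟩ʳ m) ⊕ ±e (not (r w j)) (β w ⟨$⟩ʳ j)  ∎
    where open ≡-Reasoning

  inverts : Vect n → ℕ
  inverts v = indicator (isNegative (act w v))

  inverts-e : (m : Fin n) → inverts (e m) ≡ indicator (r w m)
  inverts-e m = cong indicator (trans (cong isNegative (act-e m)) (isNegative-±e (r w m) (β w ⟨$⟩ʳ m)))

  inverts-pair : {m j : Fin n} → j Fin.< m →
                 inverts (e m ⊖ e j) + inverts (e m ⊕ e j)
                 ≡ (if β w ⟨$⟩ʳ j <ᶠ β w ⟨$⟩ʳ m then indicator (r w m) + indicator (r w m) else 1)
  inverts-pair {m} {j} j<m =
    trans (cong₂ (λ u v → indicator (isNegative u) + indicator (isNegative v)) (act-e⊖e m j) (act-e⊕e m j))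
          (negatives-in-pair (r w m) (r w j) λ βm≡βj → FinP.<⇒≢ j<m (sym (permute-injective (β w) βm≡βj)))

  inv-as-sum : (i : Fin n) → let m = opposite i in
               inv w i ≡ inverts (e m) + sum (λ j → if j <ᶠ m then inverts (e m ⊖ e j) + inverts (e m ⊕ e j) else 0)
  inv-as-sum i = begin
    inv w i
      ≡⟨ length-filter-as-sum negative? (List.map (act w) (Ψ i)) ⟩
    ℕL.sum (List.map (indicator ∘ isNegative) (List.map (act w) (Ψ i)))
      ≡⟨ cong ℕL.sum (ListP.map-∘ (Ψ i)) ⟨
    inverts (e m) + ℕL.sum (List.map inverts (pairs m))
      ≡⟨ cong (inverts (e m) +_) (sum-map-concatMap inverts _ (below m)) ⟩
    inverts (e m) + ℕL.sum (List.map pairInverts (below m))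
      ≡⟨ cong (inverts (e m) +_) (sum-map-filter (λ j → toℕ j ℕ.<? toℕ m) pairInverts (allFin _)) ⟩
    inverts (e m) + ℕL.sum (List.map (λ j → if j <ᶠ m then pairInverts j else 0) (allFin _))
      ≡⟨ cong (inverts (e m) +_) (sum-map-tabulate (λ j → if j <ᶠ m then pairInverts j else 0) id) ⟩
    inverts (e m) + sum (λ j → if j <ᶠ m then pairInverts j else 0)
      ≡⟨ cong (inverts (e m) +_) (sum-cong-≗ λ j →
           cong (λ x → if j <ᶠ m then inverts (e m ⊖ e j) + x else 0) (ℕP.+-identityʳ _)) ⟩
    inverts (e m) + sum (λ j → if j <ᶠ m then inverts (e m ⊖ e j) + inverts (e m ⊕ e j) else 0)  ∎
    where
    open ≡-Reasoning
    m = opposite i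
    pairInverts : Fin n → ℕ
    pairInverts j = ℕL.sum (List.map inverts ((e m ⊖ e j) ∷ (e m ⊕ e j) ∷ []))

inv≡invCount : (w : SignedPerm n) (i : Fin n) → inv w i ≡ invCount (β w) (r w) (opposite i)
inv≡invCount w i = begin
  inv w i
    ≡⟨ inv-as-sum w i ⟩
  inverts w (e m) + sum (λ j → if j <ᶠ m then inverts w (e m ⊖ e j) + inverts w (e m ⊕ e j) else 0)
    ≡⟨ cong₂ _+_ (inverts-e w m) (sum-cong-≗ pair-terms) ⟩
  indicator σ + sum (λ j → if j <ᶠ m then (if βw j <ᶠ βw m then indicator σ + indicator σ else 1) else 0)
    ≡⟨ entry-sum σ (_<ᶠ m) (λ j → βw j <ᶠ βw m) ⟩
  entry σ (smallerBefore (β w) m) (count (_<ᶠ m))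
    ≡⟨ cong (entry σ _) (count-<ᵇ (toℕ m) (FinP.toℕ≤n m)) ⟩
  invCount (β w) (r w) m ∎
  where
  open ≡-Reasoning
  m = opposite i
  σ = r w m
  βw : Fin _ → Fin _
  βw = β w ⟨$⟩ʳ_
  pair-terms : ∀ j → (if j <ᶠ m then inverts w (e m ⊖ e j) + inverts w (e m ⊕ e j) else 0)
                   ≡ (if j <ᶠ m then (if βw j <ᶠ βw m then indicator σ + indicator σ else 1) else 0)
  pair-terms j with j <ᶠ m in j<ᶠm
  ... | false = refl
  ... | true  = inverts-pair w (<ᶠ⇒< j m j<ᶠm)

I≡table : (w : SignedPerm n) → I w ≡ table (β w) (r w)
I≡table w = VecP.tabulate-cong (inv≡invCount w)

mainTheorem3 : (n : ℕ)
    → ((w : SignedPerm n) → InT n (I w))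
      × ((w w' : SignedPerm n) → I w ≡ I w' → w ≈B w')
      × ((a : Vec ℕ n) → InT n a → Σ (SignedPerm n) (λ w → I w ≡ a))
mainTheorem3 n = bounded , injective , surjective
  where
  bounded : (w : SignedPerm n) → InT n (I w)
  bounded w = subst (InT n) (sym (I≡table w)) (table-bounded (β w) (r w))
  injective : (w w′ : SignedPerm n) → I w ≡ I w′ → w ≈B w′
  injective w w′ Iw≡Iw′ =
    table-injective (β w) (β w′) (r w) (r w′) (trans (sym (I≡table w)) (trans Iw≡Iw′ (I≡table w′)))
  surjective : (a : Vec ℕ n) → InT n a → Σ (SignedPerm n) (λ w → I w ≡ a)
  surjective a a∈T with table-surjective a a∈T
  ... | π , s , table≡a = record { β = π ; r = s } , trans (I≡table (record { β = π ; r = s })) table≡a
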